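{- Let $P$ be a configuration of $n$ points and let $\pi_1,\dots,\pi_k$ be atoms of $\textsc{NC}(P)$ such that the corresponding edges $e_1,\dots,e_k$ form a tree with vertex set $Q\subseteq P$. Then $\operatorname{rk}(\pi_1\vee\cdots\vee\pi_k)=k$ (join taken in $\textsc{NC}(P)$) if and only if $\textsc{Conv}(e_1,\dots,e_k)\cap P=Q$.
   Context: A configuration is a finite set $P$ of $n$ distinct points in the plane. A set partition of $P$ is noncrossing if the convex hulls of its blocks are pairwise disjoint; $\textsc{NC}(P)$ is the lattice of noncrossing partitions of $P$ ordered by refinement, with $\operatorname{rk}(\pi)=n-(\text{number of blocks of }\pi)$. Each atom $\pi$ of $\textsc{NC}(P)$ has exactly one non-singleton block, which has the form $\{x,y\}$; the corresponding edge is the line segment from $x$ to $y$. $\textsc{Conv}(e_1,\dots,e_k)$ denotes the convex hull of the union of the segments. -}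

module Defs where

open import Level using (Level; _⊔_) renaming (suc to lsuc)
open import Data.Nat using (ℕ; _∸_)
open import Data.Fin using (Fin; zero; suc)
open import Data.Fin.Properties using (any?)
open import Data.Fin.Subset using (Subset; ∣_∣)
open import Data.Vec using (tabulate)
open import Data.Product using (_×_; _,_; ∃; Σ)
open import Data.Sum using (_⊎_)
open import Relation.Nullary using (¬_; does)
open import Relation.Binary.PropositionalEquality using (_≡_)
open import Relation.Binary.Structures using (IsTotalOrder)
open import Algebra.Bundles using (CommutativeRing)
import Data.Fin as F

-- Ordered fields (the plane is F × F for an ordered field F; ℝ is one).

record OrderedField (c ℓ : Level) : Set (lsuc (c ⊔ ℓ)) where
  field
    commutativeRing : CommutativeRing c ℓ
  open CommutativeRing commutativeRing public
  field
    _≤_          : Carrier → Carrier → Set ℓ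
    isTotalOrder : IsTotalOrder _≈_ _≤_
    +-mono-≤     : ∀ {a b} z → a ≤ b → (a + z) ≤ (b + z)
    *-nonneg     : ∀ {a b} → 0# ≤ a → 0# ≤ b → 0# ≤ (a * b)
    0≉1          : ¬ (0# ≈ 1#)
    inverse      : ∀ a → ¬ (a ≈ 0#) → Σ Carrier (λ b → (a * b) ≈ 1#)

-- Set partitions of Fin n, encoded by block labels: i and j lie in the
-- same block iff π i ≡ π j.  (Relabellings give the same partition;
-- every notion below depends only on the kernel of π.)

Partition : ℕ → Set
Partition n = Fin n → Fin n

SameBlock : ∀ {n} → Partition n → Fin n → Fin n → Set
SameBlock π i j = π i ≡ π j

_≼_ : ∀ {n} → Partition n → Partition n → Set
π ≼ σ = ∀ i j → π i ≡ π j → σ i ≡ σ j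

labels : ∀ {n} → Partition n → Subset n
labels {n} π = tabulate (λ b → does (any? (λ i → π i F.≟ b)))

numBlocks : ∀ {n} → Partition n → ℕ
numBlocks π = ∣ labels π ∣

rk : ∀ {n} → Partition n → ℕ
rk {n} π = n ∸ numBlocks π

module Geometry {c ℓ : Level} (𝔽 : OrderedField c ℓ) where
  open OrderedField 𝔽 using (Carrier; _≈_; _≤_; _+_; _*_; 0#; 1#)

  Point : Set c
  Point = Carrier × Carrier

  _≈ₚ_ : Point → Point → Set ℓ
  (a , b) ≈ₚ (a' , b') = (a ≈ a') × (b ≈ b')

  sumF : ∀ {n} → (Fin n → Carrier) → Carrier
  sumF {ℕ.zero}  f = 0#
  sumF {ℕ.suc n} f = f zero + sumF (λ i → f (suc i))

  InConv : ∀ {n} {s} → (Fin n → Point) → (Fin n → Set s) → Point → Set (c ⊔ ℓ ⊔ s)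
  InConv {n} P S (z₁ , z₂) =
    Σ (Fin n → Carrier) λ λ' →
      (∀ i → 0# ≤ λ' i) ×
      (∀ i → ¬ S i → λ' i ≈ 0#) ×
      (sumF λ' ≈ 1#) ×
      (z₁ ≈ sumF (λ i → λ' i * Data.Product.proj₁ (P i))) ×
      (z₂ ≈ sumF (λ i → λ' i * Data.Product.proj₂ (P i)))

  Distinct : ∀ {n} → (Fin n → Point) → Set ℓ
  Distinct P = ∀ i j → P i ≈ₚ P j → i ≡ j

  NonCrossing : ∀ {n} → (Fin n → Point) → Partition n → Set (c ⊔ ℓ)
  NonCrossing P π = ∀ i j → ¬ (π i ≡ π j) → ∀ z →
    ¬ (InConv P (λ k → π k ≡ π i) z × InConv P (λ k → π k ≡ π j) z)

  IsAtom : ∀ {n} → (Fin n → Point) → Partition n → Set (c ⊔ ℓ)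
  IsAtom P π = NonCrossing P π × (rk π ≡ 1)

  IsJoinNC : ∀ {n k} → (Fin n → Point) → (Fin k → Partition n) → Partition n → Set (c ⊔ ℓ)
  IsJoinNC P π σ =
    NonCrossing P σ × (∀ i → π i ≼ σ) ×
    (∀ τ → NonCrossing P τ → (∀ i → π i ≼ τ) → σ ≼ τ)

IsEdgeOf : ∀ {n} → Partition n → Fin n → Fin n → Set
IsEdgeOf π x y =
  ¬ (x ≡ y) ×
  (∀ a b → ¬ (a ≡ b) → (π a ≡ π b → (a ≡ x × b ≡ y) ⊎ (a ≡ y × b ≡ x))) ×
  (π x ≡ π y)

InVertexSet : ∀ {n k} → (Fin k → Fin n) → (Fin k → Fin n) → Fin n → Set
InVertexSet x y v = ∃ λ i → (v ≡ x i) ⊎ (v ≡ y i)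

data Reach {n k : ℕ} (x y : Fin k → Fin n) (allowed : Fin k → Set) : Fin n → Fin n → Set where
  here  : ∀ {a} → Reach x y allowed a a
  stepˡ : ∀ {b} i → allowed i → Reach x y allowed (y i) b → Reach x y allowed (x i) b
  stepʳ : ∀ {b} i → allowed i → Reach x y allowed (x i) b → Reach x y allowed (y i) b

-- the edges {x i , y i} (i : Fin k) form a tree (on their vertex set):
-- connected, and acyclic (every edge is a bridge: its endpoints are not
-- connected by the other edges; this also excludes repeated edges).
IsTree : ∀ {n k} → (Fin k → Fin n) → (Fin k → Fin n) → Set
IsTree {n} {k} x y =
  (∀ i → ¬ (x i ≡ y i)) ×
  (∀ a b → InVertexSet x y a → InVertexSet x y b → Reach x y (λ _ → Data.Unit.⊤) a b) ×
  (∀ i → ¬ Reach x y (λ j → ¬ (j ≡ i)) (x i) (y i))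
  where import Data.Unit

{-# OPTIONS --safe #-}
module Submission where

-- Let ρ be the partition of P into the connected components of the edge graph: its blocks are Q
-- and singletons, and since each of the k tree edges is a bridge, merging along them one at a
-- time shows that ρ has exactly n − k blocks.  The join σ coarsens ρ, so rk σ = k iff σ and ρ
-- have equally many blocks.  If Conv(Q) ∩ P = Q then ρ is itself noncrossing, hence σ = ρ.
-- Otherwise some P j with j ∉ Q lies in Conv(Q); as σ is noncrossing, j lies in the σ-block
-- containing Q, so σ merges two blocks of ρ and has strictly fewer blocks.

open import Defs
open import Level using (Level)
open import Data.Nat using (ℕ)
open import Data.Fin using (Fin)
open import Data.Product using (_×_)
open import Function.Bundles using (_⇔_)
open import Relation.Binary.PropositionalEquality using (_≡_)

open import Data.Empty using (⊥; ⊥-elim)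
open import Data.Fin using (zero; suc; _≟_)
open import Data.Fin.Properties using (any?)
open import Data.Product using (_,_; ∃; proj₁; proj₂)
open import Data.Sum using (_⊎_; inj₁; inj₂)
open import Function using (_∘_; id)
open import Function.Bundles using (mk⇔; Equivalence)
open import Relation.Nullary using (¬_; Dec; yes; no)
open import Relation.Unary using (Decidable)
open import Relation.Binary.PropositionalEquality using (_≢_; refl; sym; trans; cong; subst)
open import Data.Nat.Properties using (≤-antisym; <-irrefl)

module Partitions where

  open import Data.Bool using (true)
  open import Data.Fin.Properties using (suc-injective; 0≢1+n)
  open import Data.Fin.Subset using (Subset; _∈_; _∉_; _⊆_; _-_; ∣_∣; outside; inside)
  import Data.Fin.Subset as Subset
  open import Data.Fin.Subset.Properties using (p─⊥≡p; x∈p∧x≢y⇒x∈p-y; p─q⊆p; ⊆-antisym; ⊆⊤; ∣⊤∣≡n; ∣p∣≤n)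
  open import Data.Nat using (zero; suc; _+_; _∸_; _≤_; _<_; z≤n; s≤s)
  open import Data.Nat.Properties
    using (n<1+n; +-identityʳ; +-suc; m+n∸m≡n; ∸-cancelˡ-≡; module ≤-Reasoning)
  open import Data.Unit using (⊤; tt)
  open import Data.Vec using (_∷_; []; here; there)
  open import Data.Vec.Properties using (lookup∘tabulate; []=⇒lookup; lookup⇒[]=)
  open import Relation.Nullary using (does; proof)
  open import Relation.Nullary.Decidable using (dec-true; _⊎-dec_)
  open import Relation.Nullary.Reflects using (Reflects; invert)
  open import Relation.Binary.PropositionalEquality using (module ≡-Reasoning)

  x∉p-x : ∀ {n} {p : Subset n} x → x ∉ p - x
  x∉p-x {p = _ ∷ _} zero    ()
  x∉p-x {p = _ ∷ _} (suc x) (there x∈p-x) = x∉p-x x x∈p-x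

  ∣p∣≡suc∣p-x∣ : ∀ {n} {p : Subset n} {x} → x ∈ p → ∣ p ∣ ≡ suc ∣ p - x ∣
  ∣p∣≡suc∣p-x∣ {p = inside  ∷ p} here        = cong (suc ∘ ∣_∣) (sym (p─⊥≡p p))
  ∣p∣≡suc∣p-x∣ {p = inside  ∷ p} (there x∈p) = cong suc (∣p∣≡suc∣p-x∣ x∈p)
  ∣p∣≡suc∣p-x∣ {p = outside ∷ p} (there x∈p) = ∣p∣≡suc∣p-x∣ x∈p

  p↣q⇒∣p∣≤∣q∣ : ∀ {m n} {p : Subset m} {q : Subset n} (f : ∀ i → i ∈ p → Fin n) →
    (∀ i i∈p → f i i∈p ∈ q) → (∀ i j i∈p j∈p → f i i∈p ≡ f j j∈p → i ≡ j) → ∣ p ∣ ≤ ∣ q ∣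
  p↣q⇒∣p∣≤∣q∣ {p = []} _ _ _ = z≤n
  p↣q⇒∣p∣≤∣q∣ {p = outside ∷ p} f into injective =
    p↣q⇒∣p∣≤∣q∣ (λ i → f (suc i) ∘ there) (λ i → into (suc i) ∘ there)
      (λ i j i∈p j∈p → suc-injective ∘ injective (suc i) (suc j) (there i∈p) (there j∈p))
  p↣q⇒∣p∣≤∣q∣ {p = inside ∷ p} {q} f into injective = begin
    suc ∣ p ∣       ≤⟨ s≤s (p↣q⇒∣p∣≤∣q∣ (λ i → f (suc i) ∘ there) into-q-f₀ injective-tail) ⟩
    suc ∣ q - f₀ ∣  ≡⟨ ∣p∣≡suc∣p-x∣ (into zero here) ⟨
    ∣ q ∣           ∎
    where
    open ≤-Reasoning
    f₀ : Fin _
    f₀ = f zero here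
    into-q-f₀ : ∀ i i∈p → f (suc i) (there i∈p) ∈ q - f₀
    into-q-f₀ i i∈p = x∈p∧x≢y⇒x∈p-y (into (suc i) (there i∈p))
      (0≢1+n ∘ sym ∘ injective (suc i) zero (there i∈p) here)
    injective-tail : ∀ i j i∈p j∈p → f (suc i) (there i∈p) ≡ f (suc j) (there j∈p) → i ≡ j
    injective-tail i j i∈p j∈p = suc-injective ∘ injective (suc i) (suc j) (there i∈p) (there j∈p)

  module _ {n : ℕ} where

    ∈-labels⁻ : ∀ (π : Partition n) {b} → b ∈ labels π → ∃ λ i → π i ≡ b
    ∈-labels⁻ π {b} b∈π = invert (subst (Reflects _) used (proof (any? (λ i → π i ≟ b))))
      where
      used : does (any? (λ i → π i ≟ b)) ≡ true
      used = trans (sym (lookup∘tabulate _ b)) ([]=⇒lookup b∈π)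

    ∈-labels⁺ : ∀ (π : Partition n) {i b} → π i ≡ b → b ∈ labels π
    ∈-labels⁺ π {i} {b} πi≡b = lookup⇒[]= b (labels π)
      (trans (lookup∘tabulate _ b) (dec-true (any? (λ j → π j ≟ b)) (i , πi≡b)))

    numBlocks-id : numBlocks {n} id ≡ n
    numBlocks-id = trans (cong ∣_∣ labels≡⊤) (∣⊤∣≡n n)
      where
      labels≡⊤ : labels {n} id ≡ Subset.⊤
      labels≡⊤ = ⊆-antisym ⊆⊤ (λ {b} _ → ∈-labels⁺ id {b} refl)

    numBlocks-antitone : ∀ {ρ σ : Partition n} → ρ ≼ σ → numBlocks σ ≤ numBlocks ρ
    numBlocks-antitone {ρ} {σ} ρ≼σ = p↣q⇒∣p∣≤∣q∣ f (λ _ _ → ∈-labels⁺ ρ refl) f-injective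
      where
      f : ∀ b → b ∈ labels σ → Fin n
      f b b∈σ = ρ (proj₁ (∈-labels⁻ σ b∈σ))
      f-injective : ∀ b c b∈σ c∈σ → f b b∈σ ≡ f c c∈σ → b ≡ c
      f-injective b c b∈σ c∈σ ρi≡ρj with ∈-labels⁻ σ b∈σ | ∈-labels⁻ σ c∈σ
      ... | i , refl | j , refl = ρ≼σ i j ρi≡ρj

    merge : Partition n → Fin n → Fin n → Partition n
    merge ρ u v j with ρ j ≟ ρ u
    ... | yes _ = ρ v
    ... | no _  = ρ j

    module _ (ρ : Partition n) (u v : Fin n) where

      ≼-merge : ρ ≼ merge ρ u v
      ≼-merge a b ρa≡ρb with ρ a ≟ ρ u | ρ b ≟ ρ u
      ... | yes _   | yes _   = refl
      ... | yes a~u | no b≁u  = ⊥-elim (b≁u (trans (sym ρa≡ρb) a~u))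
      ... | no a≁u  | yes b~u = ⊥-elim (a≁u (trans ρa≡ρb b~u))
      ... | no _    | no _    = ρa≡ρb

      merge-identifies : merge ρ u v u ≡ merge ρ u v v
      merge-identifies with ρ u ≟ ρ u | ρ v ≟ ρ u
      ... | no u≁u | _     = ⊥-elim (u≁u refl)
      ... | yes _  | yes _ = refl
      ... | yes _  | no _  = refl

      merge-≡⁻ : ∀ a b → merge ρ u v a ≡ merge ρ u v b →
        ρ a ≡ ρ b ⊎ (ρ a ≡ ρ u × ρ b ≡ ρ v) ⊎ (ρ a ≡ ρ v × ρ b ≡ ρ u)
      merge-≡⁻ a b eq with ρ a ≟ ρ u | ρ b ≟ ρ u
      ... | yes a~u | yes b~u = inj₁ (trans a~u (sym b~u))
      ... | yes a~u | no _    = inj₂ (inj₁ (a~u , sym eq))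
      ... | no _    | yes b~u = inj₂ (inj₂ (eq , b~u))
      ... | no _    | no _    = inj₁ eq

      merge-least : ∀ {σ} → ρ ≼ σ → σ u ≡ σ v → merge ρ u v ≼ σ
      merge-least ρ≼σ σu≡σv a b eq with merge-≡⁻ a b eq
      ... | inj₁ a~b                = ρ≼σ a b a~b
      ... | inj₂ (inj₁ (a~u , b~v)) = trans (ρ≼σ a u a~u) (trans σu≡σv (sym (ρ≼σ b v b~v)))
      ... | inj₂ (inj₂ (a~v , b~u)) = trans (ρ≼σ a v a~v) (trans (sym σu≡σv) (sym (ρ≼σ b u b~u)))

      labels-merge : ρ u ≢ ρ v → labels (merge ρ u v) ≡ labels ρ - ρ u
      labels-merge u≁v = ⊆-antisym ⊆-minus minus-⊆
        where
        ⊆-minus : labels (merge ρ u v) ⊆ labels ρ - ρ u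
        ⊆-minus b∈ with ∈-labels⁻ (merge ρ u v) b∈
        ... | j , refl with ρ j ≟ ρ u
        ... | yes _   = x∈p∧x≢y⇒x∈p-y (∈-labels⁺ ρ refl) (u≁v ∘ sym)
        ... | no j≁u  = x∈p∧x≢y⇒x∈p-y (∈-labels⁺ ρ refl) j≁u
        minus-⊆ : labels ρ - ρ u ⊆ labels (merge ρ u v)
        minus-⊆ b∈ with ∈-labels⁻ ρ (p─q⊆p _ _ b∈)
        ... | j , refl = ∈-labels⁺ (merge ρ u v) merge-j
          where
          merge-j : merge ρ u v j ≡ ρ j
          merge-j with ρ j ≟ ρ u
          ... | yes j~u = ⊥-elim (x∉p-x (ρ u) (subst (_∈ labels ρ - ρ u) j~u b∈))
          ... | no _    = refl

      numBlocks-merge : ρ u ≢ ρ v → numBlocks ρ ≡ suc (numBlocks (merge ρ u v))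
      numBlocks-merge u≁v =
        trans (∣p∣≡suc∣p-x∣ (∈-labels⁺ ρ refl)) (cong (suc ∘ ∣_∣) (sym (labels-merge u≁v)))

    numBlocks-<-merging : ∀ {ρ σ : Partition n} {u v} → ρ ≼ σ → ρ u ≢ ρ v → σ u ≡ σ v →
      numBlocks σ < numBlocks ρ
    numBlocks-<-merging {ρ} {σ} {u} {v} ρ≼σ u≁v σu≡σv = begin-strict
      numBlocks σ                   ≤⟨ numBlocks-antitone (merge-least ρ u v ρ≼σ σu≡σv) ⟩
      numBlocks (merge ρ u v)       <⟨ n<1+n _ ⟩
      suc (numBlocks (merge ρ u v)) ≡⟨ numBlocks-merge ρ u v u≁v ⟨
      numBlocks ρ                   ∎
      where open ≤-Reasoning

    ≼-of-edge : ∀ {π τ : Partition n} {u v} → IsEdgeOf π u v → τ u ≡ τ v → π ≼ τ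
    ≼-of-edge (_ , only-uv , _) τu≡τv a b πa≡πb with a ≟ b
    ... | yes refl = refl
    ... | no a≢b with only-uv a b a≢b πa≡πb
    ... | inj₁ (refl , refl) = τu≡τv
    ... | inj₂ (refl , refl) = sym τu≡τv

    rk≡⇔numBlocks≡ : ∀ {k} {ρ σ : Partition n} → numBlocks ρ + k ≡ n →
      rk σ ≡ k ⇔ numBlocks σ ≡ numBlocks ρ
    rk≡⇔numBlocks≡ {k} {ρ} {σ} nb+k≡n = mk⇔
      (λ rkσ≡k → ∸-cancelˡ-≡ (∣p∣≤n (labels σ)) (∣p∣≤n (labels ρ)) (trans rkσ≡k (sym rkρ≡k)))
      (λ σ≡ρ → trans (cong (n ∸_) σ≡ρ) rkρ≡k)
      where
      rkρ≡k : rk ρ ≡ k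
      rkρ≡k = trans (cong (_∸ numBlocks ρ) (sym nb+k≡n)) (m+n∸m≡n (numBlocks ρ) k)

  module _ {n k : ℕ} {x y : Fin k → Fin n} where

    Reach-trans : ∀ {A a b c} → Reach x y A a b → Reach x y A b c → Reach x y A a c
    Reach-trans here          r = r
    Reach-trans (stepˡ i p q) r = stepˡ i p (Reach-trans q r)
    Reach-trans (stepʳ i p q) r = stepʳ i p (Reach-trans q r)

  Reach-lift : ∀ {n k} {x y : Fin (suc k) → Fin n} {A : Fin k → Set} {B : Fin (suc k) → Set} →
    (∀ i → A i → B (suc i)) → ∀ {a b} → Reach (x ∘ suc) (y ∘ suc) A a b → Reach x y B a b
  Reach-lift A⇒B here          = here
  Reach-lift A⇒B (stepˡ i p r) = stepˡ (suc i) (A⇒B i p) (Reach-lift A⇒B r)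
  Reach-lift A⇒B (stepʳ i p r) = stepʳ (suc i) (A⇒B i p) (Reach-lift A⇒B r)

  Connected : ∀ {n k} → (Fin k → Fin n) → (Fin k → Fin n) → Set
  Connected x y = ∀ a b → InVertexSet x y a → InVertexSet x y b → Reach x y (λ _ → ⊤) a b

  Forest : ∀ {n k} → (Fin k → Fin n) → (Fin k → Fin n) → Set
  Forest x y = ∀ i → ¬ Reach x y (λ j → j ≢ i) (x i) (y i)

  components : ∀ {n k} → (Fin k → Fin n) → (Fin k → Fin n) → Partition n
  components {k = zero}  x y = id
  components {k = suc k} x y = merge (components (x ∘ suc) (y ∘ suc)) (x zero) (y zero)

  module _ {n : ℕ} where

    InVertexSet? : ∀ {k} (x y : Fin k → Fin n) → Decidable (InVertexSet x y)
    InVertexSet? x y v = any? (λ i → (v ≟ x i) ⊎-dec (v ≟ y i))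

    components-edge : ∀ {k} (x y : Fin k → Fin n) i → components x y (x i) ≡ components x y (y i)
    components-edge x y zero    = merge-identifies (components (x ∘ suc) (y ∘ suc)) (x zero) (y zero)
    components-edge x y (suc i) = ≼-merge (components (x ∘ suc) (y ∘ suc)) (x zero) (y zero) _ _
      (components-edge (x ∘ suc) (y ∘ suc) i)

    components-least : ∀ {k} (x y : Fin k → Fin n) {σ : Partition n} → (∀ i → σ (x i) ≡ σ (y i)) →
      components x y ≼ σ
    components-least {zero}  x y σ-edge a b refl = refl
    components-least {suc k} x y σ-edge = merge-least _ (x zero) (y zero)
      (components-least (x ∘ suc) (y ∘ suc) (σ-edge ∘ suc)) (σ-edge zero)

    components⇒Reach : ∀ {k} (x y : Fin k → Fin n) a b → components x y a ≡ components x y b →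
      Reach x y (λ _ → ⊤) a b
    components⇒Reach {zero}  x y a b refl = here
    components⇒Reach {suc k} x y a b eq = via-tail (merge-≡⁻ ρ′ (x zero) (y zero) a b eq)
      where
      ρ′ : Partition n
      ρ′ = components (x ∘ suc) (y ∘ suc)
      tail : ∀ a b → ρ′ a ≡ ρ′ b → Reach x y (λ _ → ⊤) a b
      tail a b = Reach-lift (λ _ _ → tt) ∘ components⇒Reach (x ∘ suc) (y ∘ suc) a b
      via-tail : ρ′ a ≡ ρ′ b ⊎ (ρ′ a ≡ ρ′ (x zero) × ρ′ b ≡ ρ′ (y zero))
                            ⊎ (ρ′ a ≡ ρ′ (y zero) × ρ′ b ≡ ρ′ (x zero)) → Reach x y (λ _ → ⊤) a b
      via-tail (inj₁ a~b)                = tail a b a~b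
      via-tail (inj₂ (inj₁ (a~x₀ , b~y₀))) =
        Reach-trans (tail a _ a~x₀) (stepˡ zero tt (tail _ b (sym b~y₀)))
      via-tail (inj₂ (inj₂ (a~y₀ , b~x₀))) =
        Reach-trans (tail a _ a~y₀) (stepʳ zero tt (tail _ b (sym b~x₀)))

    Reach⇒components : ∀ {k} (x y : Fin k → Fin n) {A a b} → Reach x y A a b →
      components x y a ≡ components x y b
    Reach⇒components x y here          = refl
    Reach⇒components x y (stepˡ i _ r) = trans (components-edge x y i) (Reach⇒components x y r)
    Reach⇒components x y (stepʳ i _ r) = trans (sym (components-edge x y i)) (Reach⇒components x y r)

    components-connected : ∀ {k} (x y : Fin k → Fin n) → Connected x y → ∀ {a b} →
      InVertexSet x y a → InVertexSet x y b → components x y a ≡ components x y b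
    components-connected x y connected a∈V b∈V = Reach⇒components x y (connected _ _ a∈V b∈V)

    components-singleton : ∀ {k} (x y : Fin k → Fin n) {a b} → ¬ InVertexSet x y a →
      components x y a ≡ components x y b → a ≡ b
    components-singleton x y {a} a∉V eq = isolated (components⇒Reach x y a _ eq)
      where
      isolated : ∀ {b} → Reach x y (λ _ → ⊤) a b → a ≡ b
      isolated here          = refl
      isolated (stepˡ i _ _) = ⊥-elim (a∉V (i , inj₁ refl))
      isolated (stepʳ i _ _) = ⊥-elim (a∉V (i , inj₂ refl))

    numBlocks-components : ∀ {k} (x y : Fin k → Fin n) → Forest x y →
      numBlocks (components x y) + k ≡ n
    numBlocks-components {zero}  x y _      = trans (+-identityʳ _) numBlocks-id
    numBlocks-components {suc k} x y forest = begin
      numBlocks (components x y) + suc k   ≡⟨ +-suc _ k ⟩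
      suc (numBlocks (components x y)) + k ≡⟨ cong (_+ k) (numBlocks-merge ρ′ (x zero) (y zero) bridge) ⟨
      numBlocks ρ′ + k                     ≡⟨ numBlocks-components (x ∘ suc) (y ∘ suc) forest′ ⟩
      n                                    ∎
      where
      open ≡-Reasoning
      ρ′ : Partition n
      ρ′ = components (x ∘ suc) (y ∘ suc)
      bridge : ρ′ (x zero) ≢ ρ′ (y zero)
      bridge = forest zero ∘ Reach-lift (λ _ _ ()) ∘ components⇒Reach (x ∘ suc) (y ∘ suc) _ _
      forest′ : Forest (x ∘ suc) (y ∘ suc)
      forest′ i = forest (suc i) ∘ Reach-lift (λ j j≢i → j≢i ∘ suc-injective)

module ConvexHull {c ℓ : Level} (𝔽 : OrderedField c ℓ) where

  open import Data.Fin using (punchIn)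
  open import Data.Fin.Properties using (punchInᵢ≢i)
  open import Data.Vec.Functional using (replicate)
  open import Relation.Binary.Structures using (IsTotalOrder)
  import Algebra.Properties.Ring as RingProperties
  import Algebra.Properties.Semiring.Sum as SemiringSum
  import Relation.Binary.Reasoning.Setoid as SetoidReasoning

  open OrderedField 𝔽 renaming (refl to ≈-refl; sym to ≈-sym; trans to ≈-trans) hiding (zero; reflexive)
  open Geometry 𝔽
  open IsTotalOrder isTotalOrder using (total; ≲-respʳ-≈; ≲-respˡ-≈) renaming (refl to ≤-refl)
  open RingProperties ring using (-1*x≈-x; -‿involutive)
  open SemiringSum semiring using (sum; sum-remove; sum-cong-≋; sum-replicate-zero)
  open SetoidReasoning setoid

  0≤1 : 0# ≤ 1#
  0≤1 with total 0# 1#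
  ... | inj₁ 0≤1 = 0≤1
  ... | inj₂ 1≤0 = ≲-respʳ-≈ (≈-trans (-1*x≈-x (- 1#)) (-‿involutive 1#)) (*-nonneg 0≤-1 0≤-1)
    where
    0≤-1 : 0# ≤ (- 1#)
    0≤-1 = ≲-respʳ-≈ (+-identityˡ (- 1#)) (≲-respˡ-≈ (-‿inverseʳ 1#) (+-mono-≤ (- 1#) 1≤0))

  sumF≡sum : ∀ {n} (f : Fin n → Carrier) → sumF f ≡ sum f
  sumF≡sum {ℕ.zero}  f = refl
  sumF≡sum {ℕ.suc n} f = cong (f zero +_) (sumF≡sum (f ∘ suc))

  sumF-zero : ∀ {n} (f : Fin n → Carrier) → (∀ i → f i ≈ 0#) → sumF f ≈ 0#
  sumF-zero {n} f f≈0 = begin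
    sumF f               ≡⟨ sumF≡sum f ⟩
    sum f                ≈⟨ sum-cong-≋ f≈0 ⟩
    sum (replicate n 0#) ≈⟨ sum-replicate-zero n ⟩
    0#                   ∎

  sumF-single : ∀ {n} (f : Fin n → Carrier) a → (∀ i → i ≢ a → f i ≈ 0#) → sumF f ≈ f a
  sumF-single {ℕ.suc n} f a f≈0 = begin
    sumF f                     ≡⟨ sumF≡sum f ⟩
    sum f                      ≈⟨ sum-remove f ⟩
    f a + sum (f ∘ punchIn a)  ≈⟨ +-congˡ (sum-cong-≋ (λ i → f≈0 _ (punchInᵢ≢i a i))) ⟩
    f a + sum (replicate n 0#) ≈⟨ +-congˡ (sum-replicate-zero n) ⟩
    f a + 0#                   ≈⟨ +-identityʳ (f a) ⟩
    f a                        ∎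

  sumF-weighted-single : ∀ {n} (w g : Fin n → Carrier) a → (∀ i → i ≢ a → w i ≈ 0#) →
    sumF (λ i → w i * g i) ≈ w a * g a
  sumF-weighted-single w g a w≈0 =
    sumF-single (λ i → w i * g i) a (λ i i≢a → ≈-trans (*-congʳ (w≈0 i i≢a)) (zeroˡ (g i)))

  module _ {n : ℕ} where

    indicator : Fin n → Fin n → Carrier
    indicator a i with i ≟ a
    ... | yes _ = 1#
    ... | no _  = 0#

    indicator-self : ∀ a → indicator a a ≈ 1#
    indicator-self a with a ≟ a
    ... | yes _  = ≈-refl
    ... | no a≢a = ⊥-elim (a≢a refl)

    indicator-other : ∀ a i → i ≢ a → indicator a i ≈ 0#
    indicator-other a i i≢a with i ≟ a
    ... | yes i≡a = ⊥-elim (i≢a i≡a)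
    ... | no _    = ≈-refl

    indicator-nonneg : ∀ a i → 0# ≤ indicator a i
    indicator-nonneg a i with i ≟ a
    ... | yes _ = 0≤1
    ... | no _  = ≤-refl

  module _ {n : ℕ} (P : Fin n → Point) where

    InConv-vertex : ∀ {s} {S : Fin n → Set s} {j} → S j → InConv P S (P j)
    InConv-vertex {S = S} {j} j∈S =
      indicator j , indicator-nonneg j , off-S , total-weight , coordinate proj₁ , coordinate proj₂
      where
      off-S : ∀ i → ¬ S i → indicator j i ≈ 0#
      off-S i i∉S = indicator-other j i (λ { refl → i∉S j∈S })
      total-weight : sumF (indicator j) ≈ 1#
      total-weight = ≈-trans (sumF-single _ j (indicator-other j)) (indicator-self j)
      coordinate : (π : Point → Carrier) → π (P j) ≈ sumF (λ i → indicator j i * π (P i))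
      coordinate π = ≈-sym (begin
        sumF (λ i → indicator j i * π (P i))
          ≈⟨ sumF-weighted-single (indicator j) (π ∘ P) j (indicator-other j) ⟩
        indicator j j * π (P j)  ≈⟨ *-congʳ (indicator-self j) ⟩
        1# * π (P j)             ≈⟨ *-identityˡ _ ⟩
        π (P j)                  ∎)

    InConv-singleton : ∀ {s} {S : Fin n → Set s} {a z} → (∀ m → S m → m ≡ a) → InConv P S z → z ≈ₚ P a
    InConv-singleton {a = a} S⊆a (w , _ , off-S , total-weight , z₁≈ , z₂≈) =
      coordinate proj₁ z₁≈ , coordinate proj₂ z₂≈
      where
      w≈0 : ∀ i → i ≢ a → w i ≈ 0#
      w≈0 i i≢a = off-S i (i≢a ∘ S⊆a i)
      wa≈1 : w a ≈ 1#
      wa≈1 = ≈-trans (≈-sym (sumF-single w a w≈0)) total-weight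
      coordinate : ∀ (π : Point → Carrier) {t} → t ≈ sumF (λ i → w i * π (P i)) → t ≈ π (P a)
      coordinate π {t} t≈ = begin
        t                          ≈⟨ t≈ ⟩
        sumF (λ i → w i * π (P i)) ≈⟨ sumF-weighted-single w (π ∘ P) a w≈0 ⟩
        w a * π (P a)              ≈⟨ *-congʳ wa≈1 ⟩
        1# * π (P a)               ≈⟨ *-identityˡ _ ⟩
        π (P a)                    ∎

    InConv-nonempty : ∀ {s} {S : Fin n → Set s} {z} → Decidable S → InConv P S z → ∃ S
    InConv-nonempty S? (w , _ , off-S , total-weight , _) with any? S?
    ... | yes nonempty = nonempty
    ... | no empty     =
      ⊥-elim (0≉1 (≈-trans (≈-sym (sumF-zero w (λ i → off-S i (empty ∘ (i ,_))))) total-weight))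

    InConv-mono : ∀ {s t} {S : Fin n → Set s} {T : Fin n → Set t} {z} → (∀ m → S m → T m) →
      InConv P S z → InConv P T z
    InConv-mono S⊆T (w , w≥0 , off-S , rest) = w , w≥0 , (λ i i∉T → off-S i (i∉T ∘ S⊆T i)) , rest

    InConv-resp : ∀ {s} {S : Fin n → Set s} {z z′} → z ≈ₚ z′ → InConv P S z → InConv P S z′
    InConv-resp (z₁≈ , z₂≈) (w , w≥0 , off-S , total-weight , z₁≈Σ , z₂≈Σ) =
      w , w≥0 , off-S , total-weight , ≈-trans (≈-sym z₁≈) z₁≈Σ , ≈-trans (≈-sym z₂≈) z₂≈Σ

    NonCrossing-hullInBlock : ∀ {σ : Partition n} {s} {S : Fin n → Set s} {j q} → NonCrossing P σ →
      (∀ m → S m → σ m ≡ σ q) → InConv P S (P j) → σ j ≡ σ q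
    NonCrossing-hullInBlock {σ} {j = j} {q} σ-nc S⊆q Pj∈S with σ j ≟ σ q
    ... | yes same  = same
    ... | no differ = ⊥-elim (σ-nc j q differ (P j) (InConv-vertex refl , InConv-mono S⊆q Pj∈S))

    oneBlock-nonCrossing : ∀ {q} {Q : Fin n → Set q} {ρ : Partition n} → Distinct P → Decidable Q →
      (∀ {a b} → Q a → Q b → ρ a ≡ ρ b) → (∀ {a b} → ¬ Q a → ρ a ≡ ρ b → a ≡ b) →
      (∀ j → InConv P Q (P j) → Q j) → NonCrossing P ρ
    oneBlock-nonCrossing {Q = Q} {ρ} distinct Q? Q-block singleton closed i j i≁j z (z∈i , z∈j) =
      cases (Q? i) (Q? j)
      where
      block : Fin n → Fin n → Set
      block a m = ρ m ≡ ρ a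
      at-singleton : ∀ {a z} → ¬ Q a → InConv P (block a) z → z ≈ₚ P a
      at-singleton a∉Q = InConv-singleton (λ m ρm≡ρa → sym (singleton a∉Q (sym ρm≡ρa)))
      block⊆Q : ∀ {a} → Q a → ∀ m → block a m → Q m
      block⊆Q a∈Q m ρm≡ρa with Q? m
      ... | yes m∈Q = m∈Q
      ... | no m∉Q  = subst Q (sym (singleton m∉Q ρm≡ρa)) a∈Q
      apart : ∀ {a b z} → ¬ Q a → ρ a ≢ ρ b → InConv P (block a) z → ¬ InConv P (block b) z
      apart {a} {b} a∉Q a≁b z∈a z∈b with Q? b
      ... | yes b∈Q = a∉Q (closed a (InConv-resp (at-singleton a∉Q z∈a) (InConv-mono (block⊆Q b∈Q) z∈b)))
      ... | no b∉Q  = a≁b (cong ρ (distinct a b (meet (at-singleton a∉Q z∈a) (at-singleton b∉Q z∈b))))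
        where
        meet : ∀ {z p p′} → z ≈ₚ p → z ≈ₚ p′ → p ≈ₚ p′
        meet (p₁ , p₂) (p′₁ , p′₂) = ≈-trans (≈-sym p₁) p′₁ , ≈-trans (≈-sym p₂) p′₂
      cases : Dec (Q i) → Dec (Q j) → ⊥
      cases (yes i∈Q) (yes j∈Q) = i≁j (Q-block i∈Q j∈Q)
      cases (no i∉Q)  _         = apart i∉Q i≁j z∈i z∈j
      cases (yes _)   (no j∉Q)  = apart j∉Q (i≁j ∘ sym) z∈j z∈i

open Partitions
open ConvexHull

module _ {c ℓ : Level} (𝔽 : OrderedField c ℓ) {n k : ℕ} (P : Fin n → Geometry.Point 𝔽)
         (x y : Fin k → Fin n) where

  open Geometry 𝔽

  private
    Q : Fin n → Set
    Q = InVertexSet x y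
    ρ : Partition n
    ρ = components x y

  numBlocks≡⇒hull∩P⊆Q : ∀ {σ : Partition n} → NonCrossing P σ → ρ ≼ σ → numBlocks σ ≡ numBlocks ρ →
    Connected x y → ∀ j → InConv P Q (P j) → Q j
  numBlocks≡⇒hull∩P⊆Q {σ} σ-nc ρ≼σ σ≡ρ connected j Pj∈hull with InVertexSet? x y j
  ... | yes j∈Q = j∈Q
  ... | no j∉Q with InConv-nonempty 𝔽 P (InVertexSet? x y) Pj∈hull
  ... | q , q∈Q = ⊥-elim (<-irrefl σ≡ρ (numBlocks-<-merging ρ≼σ ρj≢ρq σj≡σq))
    where
    σj≡σq : σ j ≡ σ q
    σj≡σq = NonCrossing-hullInBlock 𝔽 P σ-nc
      (λ m m∈Q → ρ≼σ m q (components-connected x y connected m∈Q q∈Q)) Pj∈hull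
    ρj≢ρq : ρ j ≢ ρ q
    ρj≢ρq ρj≡ρq = j∉Q (subst Q (sym (components-singleton x y j∉Q ρj≡ρq)) q∈Q)

  components-nonCrossing : Distinct P → Connected x y → (∀ j → InConv P Q (P j) → Q j) →
    NonCrossing P ρ
  components-nonCrossing distinct connected = oneBlock-nonCrossing 𝔽 P distinct (InVertexSet? x y)
    (components-connected x y connected) (components-singleton x y)

lemma3p5 : ∀ {c ℓ : Level} (𝔽 : OrderedField c ℓ) → let open Geometry 𝔽 in
    ∀ (n k : ℕ) (P : Fin n → Point) → Distinct P →
    (π : Fin k → Partition n) → (∀ i → IsAtom P (π i)) →
    (x y : Fin k → Fin n) → (∀ i → IsEdgeOf (π i) (x i) (y i)) →
    IsTree x y →
    (σ : Partition n) → IsJoinNC P π σ →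
    (rk σ ≡ k) ⇔ (∀ j → InConv P (InVertexSet x y) (P j) ⇔ InVertexSet x y j)
lemma3p5 𝔽 n k P distinct π _ x y edge (_ , connected , forest) σ (σ-nc , π≼σ , σ-least) =
  mk⇔ rk≡k⇒hull∩P≡Q hull∩P≡Q⇒rk≡k
  where
  open Geometry 𝔽
  ρ : Partition n
  ρ = components x y
  ρ≼σ : ρ ≼ σ
  ρ≼σ = components-least x y (λ i → π≼σ i (x i) (y i) (proj₂ (proj₂ (edge i))))
  π≼ρ : ∀ i → π i ≼ ρ
  π≼ρ i = ≼-of-edge (edge i) (components-edge x y i)
  rank : rk σ ≡ k ⇔ numBlocks σ ≡ numBlocks ρ
  rank = rk≡⇔numBlocks≡ (numBlocks-components x y forest)
  rk≡k⇒hull∩P≡Q : rk σ ≡ k → ∀ j → InConv P (InVertexSet x y) (P j) ⇔ InVertexSet x y j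
  rk≡k⇒hull∩P≡Q rkσ≡k j = mk⇔
    (numBlocks≡⇒hull∩P⊆Q 𝔽 P x y σ-nc ρ≼σ (Equivalence.to rank rkσ≡k) connected j)
    (InConv-vertex 𝔽 P)
  hull∩P≡Q⇒rk≡k : (∀ j → InConv P (InVertexSet x y) (P j) ⇔ InVertexSet x y j) → rk σ ≡ k
  hull∩P≡Q⇒rk≡k hull∩P≡Q = Equivalence.from rank (≤-antisym (numBlocks-antitone ρ≼σ) (numBlocks-antitone σ≼ρ))
    where
    σ≼ρ : σ ≼ ρ
    σ≼ρ = σ-least ρ (components-nonCrossing 𝔽 P x y distinct connected (Equivalence.to ∘ hull∩P≡Q)) π≼ρ
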